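{- Let $q$ be a prime power and $d\leq e$ positive integers, and assume $q\geq 3$, or $q=2$ and $d\neq e$. For $0\leq i,j\leq d$ let $h_{\max}=\min\{j,d-i\}$, for $0\le h\le h_{\max}$ let $$T_h(i,j)=(-1)^{j-h}q^{eh+\binom{j-h}{2}}{d-h \brack d-j}_q{d-i \brack h}_q,$$ let $T_{ -1}(i,j)=0$, and let $B_j(i)=\sum_{h=0}^{h_{\max}}T_h(i,j)$. Then $$|T_{h_{\max}}(i,j)|-|T_{h_{\max}-1}(i,j)|\leq |B_j(i)|\leq |T_{h_{\max}}(i,j)|,$$ and the sign of $B_j(i)$ is $(-1)^{\max(0,\,j+i-d)}$.
   Context: For integers $N\geq 0$ and $k$, ${N \brack k}_q=\prod_{t=1}^{k}\frac{q^{N-k+t}-1}{q^t-1}$ if $0\leq k\leq N$, and $0$ if $k<0$ or $k>N$. $B_j(i)$ is the $i$-th eigenvalue of the bilinear forms graph $H_q(d,e,j)$. -}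

module Defs where

open import Data.Nat as ℕ using (ℕ; zero; suc; _+_; _*_; _∸_; _≤_; _⊔_; _⊓_)
open import Data.Nat.DivMod using (_/_)
open import Data.Nat.Primality using (Prime)
open import Data.Nat.Combinatorics using (_C_)
open import Data.Integer as ℤ using (ℤ; +_; -1ℤ)
open import Data.List using (List; map; upTo; foldr)
open import Data.Product using (Σ; _×_)
open import Data.Bool using (true; false)
open import Relation.Binary.PropositionalEquality using (_≡_)

IsPrimePower : ℕ → Set
IsPrimePower q = Σ ℕ λ p → Σ ℕ λ k → Prime p × (1 ≤ k) × (q ≡ p ℕ.^ k)

prod : ℕ → (ℕ → ℕ) → ℕ
prod zero    f = 1
prod (suc k) f = prod k f * f (suc k)

-- exact division helper (returns 0 on a zero divisor, which never occurs for q ≥ 2)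
divN : ℕ → ℕ → ℕ
divN a zero    = 0
divN a (suc b) = a / suc b

-- Gaussian binomial [N choose k]_q = ∏_{t=1}^k (q^{N-k+t} - 1)/(q^t - 1) for 0 ≤ k ≤ N, else 0.
-- (k < 0 never arises since k : ℕ.)  The product is an integer, so the division is exact.
gauss : ℕ → ℕ → ℕ → ℕ
gauss q N k with k ℕ.≤ᵇ N
... | false = 0
... | true  = divN (prod k (λ t → q ℕ.^ (N ∸ k + t) ∸ 1)) (prod k (λ t → q ℕ.^ t ∸ 1))

sumℤ : List ℤ → ℤ
sumℤ = foldr ℤ._+_ (+ 0)

hmax : ℕ → ℕ → ℕ → ℕ
hmax d i j = j ⊓ (d ∸ i)

T : (q d e i j h : ℕ) → ℤ
T q d e i j h = (-1ℤ ℤ.^ (j ∸ h)) ℤ.* + (q ℕ.^ (e * h + (j ∸ h) C 2) * gauss q (d ∸ h) (d ∸ j) * gauss q (d ∸ i) h)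

Tprev : (q d e i j : ℕ) → ℤ
Tprev q d e i j with hmax d i j
... | zero  = + 0
... | suc h = T q d e i j h

B : (q d e i j : ℕ) → ℤ
B q d e i j = sumℤ (map (T q d e i j) (upTo (suc (hmax d i j))))

-- For fixed i and j the terms T_h(i,j) alternate in sign, and their absolute values strictly
-- increase in h: the ratio ∣T_{h+1}∣ / ∣T_h∣ is
--   q^{e−j+h+1} (q^{j−h} − 1)(q^{d−i−h} − 1) / ((q^{d−h} − 1)(q^{h+1} − 1)),
-- which exceeds 1 because q^{d+1} ≤ q^e (q − 1)² when q ≥ 3 or d < e.  An alternating sum of
-- increasing positive terms has the sign of its last term, (−1)^{j−hmax} = (−1)^{max(0,i+j−d)},
-- and its absolute value lies between ∣T_hmax∣ − ∣T_{hmax−1}∣ and ∣T_hmax∣.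
module Submission where

open import Data.Nat using (ℕ)

module GaussianBinomial (c : ℕ) where

  open import Defs using (prod; divN; gauss)
  open import Data.Nat
  open import Data.Nat.Properties
  open import Data.Nat.DivMod using (m*n/n≡m)
  open import Algebra.Properties.CommutativeSemigroup *-commutativeSemigroup
    using (x∙yz≈yx∙z; xy∙z≈xz∙y; xy∙z≈x∙zy)
  open import Data.Bool.Properties using (T-≡)
  open import Function.Bundles using (Equivalence)
  open import Relation.Binary.PropositionalEquality

  divN-*-cancel : ∀ a b → 1 ≤ b → divN (a * b) b ≡ a
  divN-*-cancel a (suc b) _ = m*n/n≡m a (suc b)

  q : ℕ
  q = suc (suc c)

  q^_−1 : ℕ → ℕ
  q^ n −1 = q ^ n ∸ 1

  -- qfall 0 k is the denominator in the definition of gauss.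
  qfall : ℕ → ℕ → ℕ
  qfall m k = prod k (λ t → q^ (m + t) −1)

  qbinom : ℕ → ℕ → ℕ
  qbinom m       zero    = 1
  qbinom zero    (suc k) = 1
  qbinom (suc m) (suc k) = qbinom (suc m) k + q ^ suc k * qbinom m (suc k)

  suc-q^-1 : ∀ n → suc (q^ n −1) ≡ q ^ n
  suc-q^-1 n with q ^ n | m^n>0 q n
  ... | suc x | _ = refl

  q^-1<q^ : ∀ n → q^ n −1 < q ^ n
  q^-1<q^ n = subst (q^ n −1 <_) (suc-q^-1 n) ≤-refl

  q^-1-pos : ∀ n → 1 ≤ q^ suc n −1
  q^-1-pos n = ≤-pred (begin
    2                ≤⟨ s≤s (s≤s z≤n) ⟩
    q                ≤⟨ m≤m*n q (q ^ n) {{ m^n≢0 q n }} ⟩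
    q ^ suc n        ≡⟨ sym (suc-q^-1 (suc n)) ⟩
    suc (q^ suc n −1) ∎)
    where open ≤-Reasoning

  q^*[q-1]≤q^suc-1 : ∀ n → q ^ n * suc c ≤ q^ suc n −1
  q^*[q-1]≤q^suc-1 n with q ^ n | m^n>0 q n
  ... | suc x | _ = begin
    suc x * suc c     ≤⟨ m≤n+m _ x ⟩
    x + suc x * suc c ≡⟨ cong (x +_) (*-comm (suc x) (suc c)) ⟩
    x + suc c * suc x ∎
    where open ≤-Reasoning

  q^-1-+ : ∀ m k → q^ k −1 + q ^ k * q^ m −1 ≡ q^ (m + k) −1
  q^-1-+ m k = suc-injective (begin
    suc (q^ k −1) + q ^ k * q^ m −1 ≡⟨ cong (_+ q ^ k * q^ m −1) (suc-q^-1 k) ⟩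
    q ^ k + q ^ k * q^ m −1         ≡⟨ sym (*-suc (q ^ k) (q^ m −1)) ⟩
    q ^ k * suc (q^ m −1)           ≡⟨ cong (q ^ k *_) (suc-q^-1 m) ⟩
    q ^ k * q ^ m                   ≡⟨ sym (^-distribˡ-+-* q k m) ⟩
    q ^ (k + m)                     ≡⟨ cong (q ^_) (+-comm k m) ⟩
    q ^ (m + k)                     ≡⟨ sym (suc-q^-1 (m + k)) ⟩
    suc (q^ (m + k) −1)             ∎)
    where open ≡-Reasoning

  qfall-pos : ∀ m k → 1 ≤ qfall m k
  qfall-pos m zero    = ≤-refl
  qfall-pos m (suc k) = *-mono-≤ (qfall-pos m k) (subst (λ n → 1 ≤ q^ n −1) (sym (+-suc m k)) (q^-1-pos (m + k)))

  qfall-suc : ∀ m k → qfall m (suc k) ≡ q^ suc m −1 * qfall (suc m) k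
  qfall-suc m zero    = trans (*-identityˡ _) (trans (cong q^_−1 (+-comm m 1)) (sym (*-identityʳ _)))
  qfall-suc m (suc k) = begin
    qfall m (suc k) * q^ (m + suc (suc k)) −1               ≡⟨ cong (_* q^ (m + suc (suc k)) −1) (qfall-suc m k) ⟩
    q^ suc m −1 * qfall (suc m) k * q^ (m + suc (suc k)) −1 ≡⟨ *-assoc (q^ suc m −1) _ _ ⟩
    q^ suc m −1 * (qfall (suc m) k * q^ (m + suc (suc k)) −1) ≡⟨ cong (λ n → q^ suc m −1 * (qfall (suc m) k * q^ n −1)) (+-suc m (suc k)) ⟩
    q^ suc m −1 * qfall (suc m) (suc k)                     ∎
    where open ≡-Reasoning

  qbinom-pos : ∀ m k → 1 ≤ qbinom m k
  qbinom-pos m       zero    = ≤-refl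
  qbinom-pos zero    (suc k) = ≤-refl
  qbinom-pos (suc m) (suc k) = ≤-trans (qbinom-pos (suc m) k) (m≤m+n _ _)

  qbinom*qfall : ∀ m k → qbinom m k * qfall 0 k ≡ qfall m k
  qbinom*qfall m       zero    = refl
  qbinom*qfall zero    (suc k) = *-identityˡ _
  qbinom*qfall (suc m) (suc k) = begin
    (qbinom (suc m) k + q ^ suc k * qbinom m (suc k)) * (qfall 0 k * q^ suc k −1)
      ≡⟨ *-distribʳ-+ (qfall 0 k * q^ suc k −1) (qbinom (suc m) k) _ ⟩
    qbinom (suc m) k * (qfall 0 k * q^ suc k −1) + q ^ suc k * qbinom m (suc k) * qfall 0 (suc k)
      ≡⟨ cong₂ _+_ (sym (*-assoc (qbinom (suc m) k) (qfall 0 k) _)) (*-assoc (q ^ suc k) _ _) ⟩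
    qbinom (suc m) k * qfall 0 k * q^ suc k −1 + q ^ suc k * (qbinom m (suc k) * qfall 0 (suc k))
      ≡⟨ cong₂ (λ a b → a * q^ suc k −1 + q ^ suc k * b) (qbinom*qfall (suc m) k)
               (trans (qbinom*qfall m (suc k)) (qfall-suc m k)) ⟩
    F * q^ suc k −1 + q ^ suc k * (q^ suc m −1 * F)
      ≡⟨ cong (F * q^ suc k −1 +_) (trans (sym (*-assoc (q ^ suc k) _ _)) (*-comm _ F)) ⟩
    F * q^ suc k −1 + F * (q ^ suc k * q^ suc m −1)
      ≡⟨ sym (*-distribˡ-+ F _ _) ⟩
    F * (q^ suc k −1 + q ^ suc k * q^ suc m −1)
      ≡⟨ cong (F *_) (q^-1-+ (suc m) (suc k)) ⟩
    F * q^ (suc m + suc k) −1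
      ∎
    where
      open ≡-Reasoning
      F = qfall (suc m) k

  gauss≡qbinom : ∀ m k → gauss q (m + k) k ≡ qbinom m k
  gauss≡qbinom m k
    rewrite Equivalence.to T-≡ (≤⇒≤ᵇ (m≤n+m k m)) | m+n∸n≡m m k | sym (qbinom*qfall m k)
    = divN-*-cancel (qbinom m k) (qfall 0 k) (qfall-pos 0 k)

  gauss-pos : ∀ {N k} → k ≤ N → 1 ≤ gauss q N k
  gauss-pos {N} {k} k≤N =
    subst (λ n → 1 ≤ gauss q n k) (m∸n+n≡m k≤N)
      (subst (1 ≤_) (sym (gauss≡qbinom (N ∸ k) k)) (qbinom-pos (N ∸ k) k))

  qfall-suc≡qbinom : ∀ m k → qfall m (suc k) ≡ qbinom (suc m) k * q^ suc m −1 * qfall 0 k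
  qfall-suc≡qbinom m k = begin
    qfall m (suc k)                              ≡⟨ qfall-suc m k ⟩
    q^ suc m −1 * qfall (suc m) k                ≡⟨ cong (q^ suc m −1 *_) (sym (qbinom*qfall (suc m) k)) ⟩
    q^ suc m −1 * (qbinom (suc m) k * qfall 0 k) ≡⟨ x∙yz≈yx∙z (q^ suc m −1) (qbinom (suc m) k) (qfall 0 k) ⟩
    qbinom (suc m) k * q^ suc m −1 * qfall 0 k   ∎
    where open ≡-Reasoning

  *-cancelʳ-qfall : ∀ {x y} k → x * qfall 0 k ≡ y * qfall 0 k → x ≡ y
  *-cancelʳ-qfall {x} {y} k = *-cancelʳ-≡ x y (qfall 0 k) {{ >-nonZero (qfall-pos 0 k) }}

  qbinom-suc-top : ∀ m k → qbinom m k * q^ (suc m + k) −1 ≡ qbinom (suc m) k * q^ suc m −1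
  qbinom-suc-top m k = *-cancelʳ-qfall k (begin
    qbinom m k * q^ (suc m + k) −1 * qfall 0 k ≡⟨ xy∙z≈xz∙y (qbinom m k) _ (qfall 0 k) ⟩
    qbinom m k * qfall 0 k * q^ (suc m + k) −1 ≡⟨ cong₂ (λ x n → x * q^ n −1) (qbinom*qfall m k) (sym (+-suc m k)) ⟩
    qfall m (suc k)                            ≡⟨ qfall-suc≡qbinom m k ⟩
    qbinom (suc m) k * q^ suc m −1 * qfall 0 k ∎)
    where open ≡-Reasoning

  qbinom-suc-bottom : ∀ m k → qbinom m (suc k) * q^ suc k −1 ≡ qbinom (suc m) k * q^ suc m −1
  qbinom-suc-bottom m k = *-cancelʳ-qfall k (begin
    qbinom m (suc k) * q^ suc k −1 * qfall 0 k ≡⟨ xy∙z≈x∙zy (qbinom m (suc k)) _ (qfall 0 k) ⟩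
    qbinom m (suc k) * qfall 0 (suc k)         ≡⟨ qbinom*qfall m (suc k) ⟩
    qfall m (suc k)                            ≡⟨ qfall-suc≡qbinom m k ⟩
    qbinom (suc m) k * q^ suc m −1 * qfall 0 k ∎)
    where open ≡-Reasoning

module AlternatingSum where

  open import Defs using (sumℤ)
  open import Data.Nat as ℕ using (ℕ; zero; suc; _∸_)
  import Data.Nat.Properties as ℕ
  open import Data.Integer hiding (suc)
  open import Data.Integer.Properties
  open import Data.Integer.Tactic.RingSolver using (solve-∀)
  open import Data.List using (map; applyUpTo)
  open import Function using (_∘_)
  open import Relation.Binary.PropositionalEquality

  -1^n*-1^n≡1 : ∀ n → -1ℤ ^ n * -1ℤ ^ n ≡ 1ℤ
  -1^n*-1^n≡1 zero    = refl
  -1^n*-1^n≡1 (suc n) = trans (square-neg (-1ℤ ^ n)) (-1^n*-1^n≡1 n)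
    where
      square-neg : ∀ s → (-1ℤ * s) * (-1ℤ * s) ≡ s * s
      square-neg = solve-∀

  ∣-1^n∣≡1 : ∀ n → ∣ -1ℤ ^ n ∣ ≡ 1
  ∣-1^n∣≡1 zero    = refl
  ∣-1^n∣≡1 (suc n) = trans (abs-* -1ℤ (-1ℤ ^ n)) (trans (ℕ.*-identityˡ _) (∣-1^n∣≡1 n))

  ∣-1^n*i∣≡∣i∣ : ∀ n i → ∣ -1ℤ ^ n * i ∣ ≡ ∣ i ∣
  ∣-1^n*i∣≡∣i∣ n i = trans (abs-* (-1ℤ ^ n) i) (trans (cong (ℕ._* ∣ i ∣) (∣-1^n∣≡1 n)) (ℕ.*-identityˡ _))

  sumTo : (ℕ → ℤ) → ℕ → ℤ
  sumTo f zero    = f 0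
  sumTo f (suc n) = sumTo f n + f (suc n)

  sumTo-suc : ∀ f n → f 0 + sumTo (f ∘ suc) n ≡ sumTo f (suc n)
  sumTo-suc f zero    = refl
  sumTo-suc f (suc n) = trans (sym (+-assoc (f 0) (sumTo (f ∘ suc) n) (f (suc (suc n))))) (cong (_+ f (suc (suc n))) (sumTo-suc f n))

  sumℤ-applyUpTo : ∀ (f : ℕ → ℤ) (g : ℕ → ℕ) n → sumℤ (map f (applyUpTo g (suc n))) ≡ sumTo (f ∘ g) n
  sumℤ-applyUpTo f g zero    = +-identityʳ (f (g 0))
  sumℤ-applyUpTo f g (suc n) =
    trans (cong (_+_ (f (g 0))) (sumℤ-applyUpTo f (g ∘ suc) n)) (sumTo-suc (f ∘ g) n)

  IncreasingUpTo : (ℕ → ℕ) → ℕ → Set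
  IncreasingUpTo A n = ∀ k → suc k ℕ.≤ n → A k ℕ.< A (suc k)

  -- A n − A (n − 1) + A (n − 2) − ⋯ ± A 0, provided A is increasing (else ∸ truncates).
  altSum : (ℕ → ℕ) → ℕ → ℕ
  altSum A zero    = A 0
  altSum A (suc n) = A (suc n) ∸ altSum A n

  previous : (ℕ → ℕ) → ℕ → ℕ
  previous A zero    = 0
  previous A (suc n) = A n

  altSum≤ : ∀ A n → altSum A n ℕ.≤ A n
  altSum≤ A zero    = ℕ.≤-refl
  altSum≤ A (suc n) = ℕ.m∸n≤m (A (suc n)) (altSum A n)

  altSum-pos : ∀ A n → 0 ℕ.< A 0 → IncreasingUpTo A n → 0 ℕ.< altSum A n
  altSum-pos A zero    A0>0 _   = A0>0
  altSum-pos A (suc n) _    inc = ℕ.m<n⇒0<n∸m (ℕ.≤-<-trans (altSum≤ A n) (inc n ℕ.≤-refl))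

  A-previous≤altSum : ∀ A n → IncreasingUpTo A n → + A n - + previous A n ≤ + altSum A n
  A-previous≤altSum A zero    _   = ≤-reflexive (+-identityʳ (+ A 0))
  A-previous≤altSum A (suc n) inc = begin
    + A (suc n) - + A n ≡⟨ m-n≡m⊖n (A (suc n)) (A n) ⟩
    A (suc n) ⊖ A n     ≡⟨ ⊖-≥ (ℕ.<⇒≤ (inc n ℕ.≤-refl)) ⟩
    + (A (suc n) ∸ A n) ≤⟨ +≤+ (ℕ.∸-monoʳ-≤ (A (suc n)) (altSum≤ A n)) ⟩
    + altSum A (suc n)  ∎
    where open ≤-Reasoning

  sign*sumTo≡altSum : ∀ j A n → n ℕ.≤ j → IncreasingUpTo A n →
                 -1ℤ ^ (j ∸ n) * sumTo (λ h → -1ℤ ^ (j ∸ h) * + A h) n ≡ + altSum A n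
  sign*sumTo≡altSum j A zero    _   _   = begin
    s * (s * + A 0) ≡⟨ sym (*-assoc s s _) ⟩
    s * s * + A 0   ≡⟨ cong (_* + A 0) (-1^n*-1^n≡1 j) ⟩
    1ℤ * + A 0      ≡⟨ *-identityˡ _ ⟩
    + A 0           ∎
    where
      open ≡-Reasoning
      s = -1ℤ ^ j
  sign*sumTo≡altSum j A (suc n) n<j inc = begin
    s * (S + s * + A (suc n))             ≡⟨ expand s S (+ A (suc n)) ⟩
    - (-1ℤ * s * S) + s * s * + A (suc n) ≡⟨ cong₂ (λ x y → - x + y * + A (suc n)) previous-sum (-1^n*-1^n≡1 (j ∸ suc n)) ⟩
    - + altSum A n + 1ℤ * + A (suc n)     ≡⟨ cong (_+_ (- + altSum A n)) (*-identityˡ _) ⟩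
    - + altSum A n + + A (suc n)          ≡⟨ +-comm (- + altSum A n) _ ⟩
    + A (suc n) - + altSum A n            ≡⟨ m-n≡m⊖n (A (suc n)) (altSum A n) ⟩
    A (suc n) ⊖ altSum A n                ≡⟨ ⊖-≥ (ℕ.≤-trans (altSum≤ A n) (ℕ.<⇒≤ (inc n ℕ.≤-refl))) ⟩
    + altSum A (suc n)                    ∎
    where
      open ≡-Reasoning
      s = -1ℤ ^ (j ∸ suc n)
      S = sumTo (λ h → -1ℤ ^ (j ∸ h) * + A h) n
      expand : ∀ s S a → s * (S + s * a) ≡ - (-1ℤ * s * S) + s * s * a
      expand = solve-∀
      previous-sum : -1ℤ * s * S ≡ + altSum A n
      previous-sum = trans (cong (λ t → -1ℤ ^ t * S) (sym (ℕ.+-∸-assoc 1 n<j)))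
                           (sign*sumTo≡altSum j A n (ℕ.<⇒≤ n<j) (λ k k<n → inc k (ℕ.m≤n⇒m≤1+n k<n)))

module Magnitude (c : ℕ) where

  open import Defs using (gauss)
  open import Data.Nat
  open import Data.Nat.Properties
  open import Data.Nat.Combinatorics using (_C_; nC1≡n; nCk+nC[k+1]≡[n+1]C[k+1])
  open import Data.Nat.Tactic.RingSolver using (solve-∀)
  open import Data.Sum using (_⊎_; inj₁; inj₂)
  open import Relation.Binary.PropositionalEquality

  [1+n]C2≡n+nC2 : ∀ n → suc n C 2 ≡ n + n C 2
  [1+n]C2≡n+nC2 n = trans (sym (nCk+nC[k+1]≡[n+1]C[k+1] n 1)) (cong (_+ n C 2) (nC1≡n n))

  open GaussianBinomial c
  open AlternatingSum using (IncreasingUpTo)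

  -- ∣T_h(i,j)∣, with n standing for d − i.
  magnitude : (d e n j h : ℕ) → ℕ
  magnitude d e n j h = q ^ (e * h + (j ∸ h) C 2) * gauss q (d ∸ h) (d ∸ j) * gauss q n h

  magnitude-pos : ∀ {d e n j h} → h ≤ j → j ≤ d → h ≤ n → 0 < magnitude d e n j h
  magnitude-pos {d} {e} {n} {j} {h} h≤j j≤d h≤n =
    *-mono-≤ (*-mono-≤ (m^n>0 q (e * h + (j ∸ h) C 2)) (gauss-pos (∸-monoʳ-≤ d h≤j))) (gauss-pos h≤n)

  magnitude≡qbinom : ∀ e j a m h → h ≤ j →
    magnitude (j + a) e (m + h) j h ≡ q ^ (e * h + (j ∸ h) C 2) * qbinom (j ∸ h) a * qbinom m h
  magnitude≡qbinom e j a m h h≤j = cong₂ (λ x y → q ^ (e * h + (j ∸ h) C 2) * x * y)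
    (trans (cong₂ (gauss q) (+-∸-comm a h≤j) (m+n∸m≡n j a)) (gauss≡qbinom (j ∸ h) a))
    (gauss≡qbinom m h)

  q-ineq : ∀ r k a m u → suc r + k + a ≤ u + r → (1 ≤ c ⊎ suc r + k + a < u + r) →
           q^ (suc r + a) −1 * q^ suc k −1 < q ^ u * q^ suc r −1 * q^ suc m −1
  q-ineq r k a m u d≤e cases = begin-strict
    q^ (suc r + a) −1 * q^ suc k −1 <⟨ *-mono-< (q^-1<q^ (suc r + a)) (q^-1<q^ (suc k)) ⟩
    q ^ (suc r + a) * q ^ suc k   ≡⟨ sym (^-distribˡ-+-* q (suc r + a) (suc k)) ⟩
    q ^ (suc r + a + suc k)       ≡⟨ cong (q ^_) (exponents r k a) ⟩
    q ^ suc d                     ≤⟨ q^suc-d≤ cases ⟩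
    q ^ (u + r) * (q-1 * q-1)      ≡⟨ regroup ⟩
    q ^ u * (q ^ r * q-1) * q-1    ≤⟨ *-monoˡ-≤ q-1 (*-monoʳ-≤ (q ^ u) (q^*[q-1]≤q^suc-1 r)) ⟩
    q ^ u * q^ suc r −1 * q-1      ≤⟨ *-monoʳ-≤ (q ^ u * q^ suc r −1) q-1≤q^suc-m-1 ⟩
    q ^ u * q^ suc r −1 * q^ suc m −1 ∎
    where
      open ≤-Reasoning
      d = suc r + k + a
      q-1 = suc c
      exponents : ∀ r k a → suc r + a + suc k ≡ suc (suc r + k + a)
      exponents = solve-∀
      regroup : q ^ (u + r) * (q-1 * q-1) ≡ q ^ u * (q ^ r * q-1) * q-1
      regroup = trans (cong (_* (q-1 * q-1)) (^-distribˡ-+-* q u r)) (reassoc (q ^ u) (q ^ r) q-1)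
        where
          reassoc : ∀ x y z → x * y * (z * z) ≡ x * (y * z) * z
          reassoc = solve-∀
      q-1≤q^suc-m-1 : q-1 ≤ q^ suc m −1
      q-1≤q^suc-m-1 = ≤-trans (m≤n*m q-1 (q ^ m) {{ m^n≢0 q m }}) (q^*[q-1]≤q^suc-1 m)
      -- for q ≥ 3 the factor (q − 1)² ≥ q absorbs one power of q; for q = 2 the exponent must do it
      q^suc-d≤ : (1 ≤ c ⊎ d < u + r) → q ^ suc d ≤ q ^ (u + r) * (q-1 * q-1)
      q^suc-d≤ (inj₁ 1≤c) = begin
        q * q ^ d               ≡⟨ *-comm q (q ^ d) ⟩
        q ^ d * q               ≤⟨ *-mono-≤ (^-monoʳ-≤ q d≤e) (s≤s (≤-trans (+-monoˡ-≤ c 1≤c) (+-monoʳ-≤ c (m≤m*n c q-1)))) ⟩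
        q ^ (u + r) * (q-1 * q-1) ∎
      q^suc-d≤ (inj₂ d<e) = ≤-trans (^-monoʳ-≤ q d<e) (m≤m*n (q ^ (u + r)) (q-1 * q-1))

  magnitude-ratio : ∀ r k a m u →
    let d = suc r + k + a ; e = u + r ; n = suc m + k ; j = suc r + k in
    magnitude d e n j (suc k) * (q^ (suc r + a) −1 * q^ suc k −1)
      ≡ magnitude d e n j k * (q ^ u * q^ suc r −1 * q^ suc m −1)
  magnitude-ratio r k a m u = begin
    magnitude d e n j (suc k) * (Wtop * q^ suc k −1)
      ≡⟨ cong (_* (Wtop * q^ suc k −1)) at-suc-k ⟩
    q ^ E * q ^ u * qbinom r a * qbinom m (suc k) * (Wtop * q^ suc k −1)
      ≡⟨ regroup (q ^ E) (q ^ u) (qbinom r a) (qbinom m (suc k)) Wtop (q^ suc k −1) ⟩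
    q ^ E * q ^ u * (qbinom r a * Wtop) * (qbinom m (suc k) * q^ suc k −1)
      ≡⟨ cong₂ (λ x y → q ^ E * q ^ u * x * y) (qbinom-suc-top r a) (qbinom-suc-bottom m k) ⟩
    q ^ E * q ^ u * (qbinom (suc r) a * q^ suc r −1) * (qbinom (suc m) k * q^ suc m −1)
      ≡⟨ regroup′ (q ^ E) (q ^ u) (qbinom (suc r) a) (qbinom (suc m) k) (q^ suc r −1) (q^ suc m −1) ⟩
    q ^ E * qbinom (suc r) a * qbinom (suc m) k * (q ^ u * q^ suc r −1 * q^ suc m −1)
      ≡⟨ cong (_* (q ^ u * q^ suc r −1 * q^ suc m −1)) (sym at-k) ⟩
    magnitude d e n j k * (q ^ u * q^ suc r −1 * q^ suc m −1)
      ∎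
    where
      open ≡-Reasoning
      d = suc r + k + a
      e = u + r
      n = suc m + k
      j = suc r + k
      E = e * k + suc r C 2
      Wtop = q^ (suc r + a) −1
      at-k : magnitude d e n j k ≡ q ^ E * qbinom (suc r) a * qbinom (suc m) k
      at-k = trans (magnitude≡qbinom e j a (suc m) k (m≤n+m k (suc r)))
                   (cong (λ t → q ^ (e * k + t C 2) * qbinom t a * qbinom (suc m) k) (m+n∸n≡m (suc r) k))
      exponent : ∀ u r k x → (u + r) * suc k + x ≡ (u + r) * k + (r + x) + u
      exponent = solve-∀
      at-suc-k : magnitude d e n j (suc k) ≡ q ^ E * q ^ u * qbinom r a * qbinom m (suc k)
      at-suc-k = begin
        magnitude d e (suc m + k) j (suc k)
          ≡⟨ cong (λ n′ → magnitude d e n′ j (suc k)) (sym (+-suc m k)) ⟩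
        magnitude d e (m + suc k) j (suc k)
          ≡⟨ magnitude≡qbinom e j a m (suc k) (s≤s (m≤n+m k r)) ⟩
        q ^ (e * suc k + (r + k ∸ k) C 2) * qbinom (r + k ∸ k) a * qbinom m (suc k)
          ≡⟨ cong (λ t → q ^ (e * suc k + t C 2) * qbinom t a * qbinom m (suc k)) (m+n∸n≡m r k) ⟩
        q ^ (e * suc k + r C 2) * qbinom r a * qbinom m (suc k)
          ≡⟨ cong (λ t → q ^ t * qbinom r a * qbinom m (suc k))
                  (trans (exponent u r k (r C 2)) (cong (λ t → e * k + t + u) (sym ([1+n]C2≡n+nC2 r)))) ⟩
        q ^ (E + u) * qbinom r a * qbinom m (suc k)
          ≡⟨ cong (λ t → t * qbinom r a * qbinom m (suc k)) (^-distribˡ-+-* q E u) ⟩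
        q ^ E * q ^ u * qbinom r a * qbinom m (suc k)
          ∎
      regroup : ∀ x y z w s t → x * y * z * w * (s * t) ≡ x * y * (z * s) * (w * t)
      regroup = solve-∀
      regroup′ : ∀ x y z w s t → x * y * (z * s) * (w * t) ≡ x * z * w * (y * s * t)
      regroup′ = solve-∀

  magnitude-<-suc : ∀ r k a m u → suc r + k + a ≤ u + r → (1 ≤ c ⊎ suc r + k + a < u + r) →
    let d = suc r + k + a ; e = u + r ; n = suc m + k ; j = suc r + k in
    magnitude d e n j k < magnitude d e n j (suc k)
  magnitude-<-suc r k a m u d≤e cases = *-cancelʳ-< _ _ _ (begin-strict
    magnitude d e n j k * (q^ (suc r + a) −1 * q^ suc k −1)
      <⟨ *-monoʳ-< (magnitude d e n j k) {{ >-nonZero positive }} (q-ineq r k a m u d≤e cases) ⟩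
    magnitude d e n j k * (q ^ u * q^ suc r −1 * q^ suc m −1)
      ≡⟨ sym (magnitude-ratio r k a m u) ⟩
    magnitude d e n j (suc k) * (q^ (suc r + a) −1 * q^ suc k −1)
      ∎)
    where
      open ≤-Reasoning
      d = suc r + k + a
      e = u + r
      n = suc m + k
      j = suc r + k
      positive : 0 < magnitude d e n j k
      positive = magnitude-pos {e = e} (m≤n+m k (suc r)) (m≤m+n j a) (m≤n+m k (suc m))

  magnitude-increasing : ∀ {d e n j} → j ≤ d → d ≤ e → (1 ≤ c ⊎ d < e) →
                         IncreasingUpTo (magnitude d e n j) (j ⊓ n)
  magnitude-increasing {d} {e} {n} {j} j≤d d≤e cases k k<j⊓n =
    decomposed (j ∸ suc k) (n ∸ suc k) (d ∸ j) (e ∸ (j ∸ suc k))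
      (trans (sym (m∸n+n≡m k<j)) (+-suc _ k)) (trans (sym (m∸n+n≡m k<n)) (+-suc _ k))
      (sym (m+[n∸m]≡n j≤d)) (sym (m∸n+n≡m (≤-trans (m∸n≤m j (suc k)) (≤-trans j≤d d≤e))))
      d≤e cases
    where
      k<j = ≤-trans k<j⊓n (m⊓n≤m j n)
      k<n = ≤-trans k<j⊓n (m⊓n≤n j n)
      decomposed : ∀ {d e n j} r m a u → j ≡ suc r + k → n ≡ suc m + k → d ≡ j + a → e ≡ u + r →
                   d ≤ e → (1 ≤ c ⊎ d < e) → magnitude d e n j k < magnitude d e n j (suc k)
      decomposed r m a u refl refl refl refl = magnitude-<-suc r k a m u

module Bounds where

  open import Defs
  open import Data.Nat using (zero; suc; z≤n; _≤_; _<_; _+_; _∸_; _⊓_; nonTrivial⇒n>1)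
  import Data.Nat as ℕ
  open import Data.Nat.Properties
  open import Data.Nat.Primality using (prime⇒nonTrivial; prime⇒nonZero)
  open import Data.Integer using (+_; -1ℤ; _-_; _*_; _^_; ∣_∣; +<+) renaming (_≤_ to _≤ℤ_; _<_ to _<ℤ_)
  open import Data.Product using (_,_)
  open import Data.Sum using (_⊎_)
  open import Relation.Binary.PropositionalEquality
  open AlternatingSum

  primePower≥2 : ∀ {q} → IsPrimePower q → 2 ≤ q
  primePower≥2 (p , suc k , pr , _ , refl) =
    ≤-trans (nonTrivial⇒n>1 p {{prime⇒nonTrivial pr}}) (m≤m*n p (p ℕ.^ k) {{m^n≢0 p k {{prime⇒nonZero pr}}}})

  j∸[j⊓n]≡j∸n : ∀ j n → j ∸ (j ⊓ n) ≡ j ∸ n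
  j∸[j⊓n]≡j∸n j n = trans (cong (_∸ (j ⊓ n)) (sym j⊓n+j∸n≡j)) (m+n∸m≡n (j ⊓ n) (j ∸ n))
    where
      j⊓n+j∸n≡j : j ⊓ n + (j ∸ n) ≡ j
      j⊓n+j∸n≡j = trans (cong (_+ (j ∸ n)) (⊓-comm j n)) (m⊓n+n∸m≡n n j)

  [j+i]∸d≡j∸hmax : ∀ {d i} j → i ≤ d → (j + i) ∸ d ≡ j ∸ hmax d i j
  [j+i]∸d≡j∸hmax {d} {i} j i≤d = begin
    (j + i) ∸ d             ≡⟨ cong ((j + i) ∸_) (sym (m+[n∸m]≡n i≤d)) ⟩
    (j + i) ∸ (i + (d ∸ i)) ≡⟨ sym (∸-+-assoc (j + i) i (d ∸ i)) ⟩
    (j + i ∸ i) ∸ (d ∸ i)   ≡⟨ cong (_∸ (d ∸ i)) (m+n∸n≡m j i) ⟩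
    j ∸ (d ∸ i)             ≡⟨ sym (j∸[j⊓n]≡j∸n j (d ∸ i)) ⟩
    j ∸ (j ⊓ (d ∸ i))       ∎
    where open ≡-Reasoning

  module _ (c : ℕ) where

    open GaussianBinomial c using (q)
    open Magnitude c

    ∣Tprev∣≡previous : ∀ d e i j → ∣ Tprev q d e i j ∣ ≡ previous (magnitude d e (d ∸ i) j) (hmax d i j)
    ∣Tprev∣≡previous d e i j with hmax d i j
    ... | zero  = refl
    ... | suc h = ∣-1^n*i∣≡∣i∣ (j ∸ h) _

    module _ {d e i j} (i≤d : i ≤ d) (j≤d : j ≤ d) (d≤e : d ≤ e) (cases : 1 ≤ c ⊎ d < e) where

      private
        A = magnitude d e (d ∸ i) j
        h = hmax d i j
        increasing : IncreasingUpTo A h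
        increasing = magnitude-increasing j≤d d≤e cases

      signed-B≡altSum : -1ℤ ^ (j ∸ h) * B q d e i j ≡ + altSum A h
      signed-B≡altSum = trans (cong (-1ℤ ^ (j ∸ h) *_) (sumℤ-applyUpTo (T q d e i j) (λ x → x) h))
                              (sign*sumTo≡altSum j A h (m⊓n≤m j (d ∸ i)) increasing)

      ∣B∣≡altSum : ∣ B q d e i j ∣ ≡ altSum A h
      ∣B∣≡altSum = trans (sym (∣-1^n*i∣≡∣i∣ (j ∸ h) (B q d e i j))) (cong ∣_∣ signed-B≡altSum)

      B-lower : + ∣ T q d e i j h ∣ - + ∣ Tprev q d e i j ∣ ≤ℤ + ∣ B q d e i j ∣
      B-lower rewrite ∣-1^n*i∣≡∣i∣ (j ∸ h) (+ A h) | ∣Tprev∣≡previous d e i j | ∣B∣≡altSum =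
        A-previous≤altSum A h increasing

      B-upper : ∣ B q d e i j ∣ ≤ ∣ T q d e i j h ∣
      B-upper rewrite ∣-1^n*i∣≡∣i∣ (j ∸ h) (+ A h) | ∣B∣≡altSum = altSum≤ A h

      B-sign : + 0 <ℤ -1ℤ ^ ((j + i) ∸ d) * B q d e i j
      B-sign rewrite [j+i]∸d≡j∸hmax j i≤d | signed-B≡altSum =
        +<+ (altSum-pos A h (magnitude-pos {e = e} {n = d ∸ i} z≤n j≤d z≤n) increasing)

open import Defs
open import Data.Nat using (suc; s≤s; _≤_; _<_; _∸_; _+_)
open import Data.Nat.Properties using (≤∧≢⇒<)
open import Data.Integer using (+_; -1ℤ; _-_; _*_; _^_; ∣_∣) renaming (_≤_ to _≤ℤ_; _<_ to _<ℤ_)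
open import Data.Product using (_×_; _,_)
open import Data.Sum using (_⊎_; map)
open import Relation.Binary.PropositionalEquality using (_≡_; _≢_)
open Bounds

lemma4p1 : (q d e : ℕ) → IsPrimePower q → 1 ≤ d → d ≤ e →
    (3 ≤ q ⊎ (q ≡ 2 × d ≢ e)) →
    (i j : ℕ) → i ≤ d → j ≤ d →
    ((+ ∣ T q d e i j (hmax d i j) ∣ - + ∣ Tprev q d e i j ∣) ≤ℤ + ∣ B q d e i j ∣)
    × (∣ B q d e i j ∣ ≤ ∣ T q d e i j (hmax d i j) ∣)
    × (+ 0 <ℤ (-1ℤ ^ ((j + i) ∸ d)) * B q d e i j)
lemma4p1 q d e pp _ d≤e cases i j i≤d j≤d with primePower≥2 pp
lemma4p1 .(suc (suc c)) d e _ _ d≤e cases i j i≤d j≤d | s≤s (s≤s {n = c} _) =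
  B-lower c i≤d j≤d d≤e cases′ , B-upper c i≤d j≤d d≤e cases′ , B-sign c i≤d j≤d d≤e cases′
  where
    cases′ : 1 ≤ c ⊎ d < e
    cases′ = map (λ { (s≤s (s≤s 1≤c)) → 1≤c }) (λ { (_ , d≢e) → ≤∧≢⇒< d≤e d≢e }) cases
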